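{- Let $k$ be a positive integer and $n=2k+1$. Then $\alpha(k,2k+1)\le 4k+5$.
   Context: For integers $1\le k\le n$, $\alpha(k,n)$ denotes the least number of entries equal to $1$ in an $n\times n$ matrix with entries in $\{0,1\}$ in which every $k\times k$ minor (the submatrix formed by any $k$ rows and any $k$ columns) contains at least one entry equal to $1$. -}

module Defs where

open import Data.Nat using (ℕ; _+_; _≤_)
open import Data.Bool using (Bool; true; false)
open import Data.Fin using (Fin)
open import Data.List using (List; map; allFin)
open import Data.Nat.ListAction using (sum)

open import Data.Product using (Σ; _×_; ∃; ∃-syntax)
open import Function.Definitions using (Injective)
open import Relation.Binary.PropositionalEquality using (_≡_)

-- An n×n 0/1 matrix: entry i j is true iff it equals 1.
Matrix01 : ℕ → Set
Matrix01 n = Fin n → Fin n → Bool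

bit : Bool → ℕ
bit true  = 1
bit false = 0

ones : ∀ {n} → Matrix01 n → ℕ
ones {n} M = sum (map (λ i → sum (map (λ j → bit (M i j)) (allFin n))) (allFin n))

EveryMinorHasOne : (k : ℕ) → ∀ {n} → Matrix01 n → Set
EveryMinorHasOne k {n} M =
  (r c : Fin k → Fin n) → Injective _≡_ _≡_ r → Injective _≡_ _≡_ c →
  ∃[ a ] ∃[ b ] (M (r a) (c b) ≡ true)

-- α(k,n) ≤ m : since α(k,n) is the least number of ones in such a matrix,
-- α(k,n) ≤ m holds iff some such matrix has at most m ones.
α≤ : ℕ → ℕ → ℕ → Set
α≤ k n m = Σ (Matrix01 n) λ M → EveryMinorHasOne k M × (ones M ≤ m)

-- The matrix lives on the cycle ℤ/(2k+1): it has a one at (u, u), at (u, u+1) and at the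
-- three chords (v+k, v) for v ∈ {0, k, 2k}, hence 2(2k+1)+3 = 4k+5 ones.  Suppose k rows R
-- and k columns C meet no one.  The diagonal makes R and C disjoint, so exactly one point x
-- lies outside R ∪ C.  The superdiagonal forbids stepping from R into C, so walking along
-- the cycle from x the points x+1, …, x+2k read C⋯C R⋯R, and as |R| = |C| = k the first k
-- are columns and the last k are rows.  Consecutive chord columns 0, k, 2k are at most k
-- apart, so some x+t with 1 ≤ t ≤ k is a chord column v; then x+t+k = v+k is a row, and
-- (v+k, v) is a one of the minor.
module Submission where

open import Defs
open import Data.Nat using (ℕ; zero; suc; _+_; _*_; _∸_; _%_; _≤_; _<_; _≤′_; ≤′-refl; ≤′-step; z≤n; s≤s; NonZero)
open import Data.Nat.Properties hiding (_≟_)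
open import Data.Nat.DivMod using (_mod_; m%n<n; m%n%n≡m%n; n%n≡0; %-distribˡ-+; [m+n]%n≡m%n; m<n⇒m%n≡m)
open import Data.Nat.ListAction using (sum)
open import Data.Nat.Tactic.RingSolver using (solve-∀)
open import Algebra.Properties.CommutativeMonoid.Sum +-0-commutativeMonoid using (sum-syntax; sum-cong-≗; ∑-distrib-+; sum-replicate-zero)
open import Algebra.Properties.CommutativeSemigroup +-commutativeSemigroup using (x∙yz≈y∙xz)
open import Data.Bool using (true; false; _∧_; _∨_)
open import Data.Bool.Properties using (∨-conicalˡ; ∨-conicalʳ; ¬-not) renaming (_≟_ to _≟ᵇ_)
open import Data.Fin using (Fin; zero; suc; toℕ; splitAt; join; punchOut)
open import Data.Fin.Properties using (_≟_; toℕ-injective; toℕ<n; toℕ-fromℕ<; toℕ≤pred[n]; any?; ¬∀⟶∃¬; injective⇒≤; punchOut-injective; join-splitAt)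
open import Data.Fin.Patterns using (0F; 1F; 2F)
open import Data.List using (map; tabulate; allFin)
open import Data.Empty using (⊥)
open import Data.Product using (∃; ∃₂; _×_; _,_; proj₁; proj₂)
open import Data.Sum using (_⊎_; inj₁; inj₂; [_,_])
open import Data.Vec.Functional using (_++_)
open import Function using (_∘_; id)
open import Function.Definitions using (Injective)
open import Relation.Binary.PropositionalEquality using (_≡_; _≢_; refl; sym; trans; cong; cong₂; subst; module ≡-Reasoning)
open import Relation.Nullary using (¬_; yes; no; does; contradiction)
open import Relation.Nullary.Decidable using (dec-true)

private variable
  k m n : ℕ

sum-map-tabulate : {A : Set} (f : A → ℕ) (g : Fin n → A) →
                   sum (map f (tabulate g)) ≡ ∑[ i < n ] f (g i)
sum-map-tabulate {zero}  f g = refl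
sum-map-tabulate {suc n} f g = cong (f (g zero) +_) (sum-map-tabulate f (g ∘ suc))

∑-mono-≤ : {f g : Fin n → ℕ} → (∀ i → f i ≤ g i) → ∑[ i < n ] f i ≤ ∑[ i < n ] g i
∑-mono-≤ {zero}  _   = z≤n
∑-mono-≤ {suc n} f≤g = +-mono-≤ (f≤g zero) (∑-mono-≤ (f≤g ∘ suc))

∑-const-1 : ∑[ i < n ] 1 ≡ n
∑-const-1 {zero}  = refl
∑-const-1 {suc n} = cong suc (∑-const-1 {n})

∑-bit-≟ : (u : Fin n) → ∑[ j < n ] bit (does (j ≟ u)) ≡ 1
∑-bit-≟ {suc n} zero    = cong suc (sum-replicate-zero n)
∑-bit-≟ {suc n} (suc u) = ∑-bit-≟ u

bit-∨ : ∀ a b → bit (a ∨ b) ≤ bit a + bit b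
bit-∨ true  _ = s≤s z≤n
bit-∨ false _ = ≤-refl

infixr 5 _∪_

_∪_ : Matrix01 n → Matrix01 n → Matrix01 n
(M ∪ N) i j = M i j ∨ N i j

graph : (Fin n → Fin n) → Matrix01 n
graph f i j = does (j ≟ f i)

entry : Fin n → Fin n → Matrix01 n
entry u v i j = does (i ≟ u) ∧ does (j ≟ v)

ones-∑ : (M : Matrix01 n) → ones M ≡ ∑[ i < n ] ∑[ j < n ] bit (M i j)
ones-∑ {n} M = trans (sum-map-tabulate (λ i → sum (map (λ j → bit (M i j)) (allFin n))) id)
                     (sum-cong-≗ (λ i → sum-map-tabulate (λ j → bit (M i j)) id))

ones-∪-≤ : ∀ {a b} (M N : Matrix01 n) → ones M ≤ a → ones N ≤ b → ones (M ∪ N) ≤ a + b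
ones-∪-≤ {n} {a} {b} M N M≤a N≤b = begin
  ones (M ∪ N)                                                   ≡⟨ ones-∑ (M ∪ N) ⟩
  ∑[ i < n ] ∑[ j < n ] bit (M i j ∨ N i j)                       ≤⟨ ∑-mono-≤ (λ i → ∑-mono-≤ (λ j → bit-∨ (M i j) (N i j))) ⟩
  ∑[ i < n ] ∑[ j < n ] (bit (M i j) + bit (N i j))              ≡⟨ sum-cong-≗ (λ i → ∑-distrib-+ (λ j → bit (M i j)) (λ j → bit (N i j))) ⟩
  ∑[ i < n ] (∑[ j < n ] bit (M i j) + ∑[ j < n ] bit (N i j))   ≡⟨ ∑-distrib-+ (λ i → ∑[ j < n ] bit (M i j)) (λ i → ∑[ j < n ] bit (N i j)) ⟩
  ∑[ i < n ] ∑[ j < n ] bit (M i j) + ∑[ i < n ] ∑[ j < n ] bit (N i j) ≡⟨ cong₂ _+_ (ones-∑ M) (ones-∑ N) ⟨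
  ones M + ones N                                                ≤⟨ +-mono-≤ M≤a N≤b ⟩
  a + b                                                          ∎
  where open ≤-Reasoning

ones-graph : (f : Fin n → Fin n) → ones (graph f) ≡ n
ones-graph f = trans (ones-∑ (graph f)) (trans (sum-cong-≗ (λ i → ∑-bit-≟ (f i))) ∑-const-1)

ones-entry : (u v : Fin n) → ones (entry u v) ≡ 1
ones-entry {n} u v = trans (ones-∑ (entry u v)) (trans (sum-cong-≗ (λ i → row (does (i ≟ u)))) (∑-bit-≟ u))
  where
  row : ∀ b → ∑[ j < n ] bit (b ∧ does (j ≟ v)) ≡ bit b
  row true  = ∑-bit-≟ v
  row false = sum-replicate-zero n

-- A record rather than a function type, so that r and c are recovered by unification.
record ZeroMinor (M : Matrix01 n) (r c : Fin k → Fin n) : Set where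
  constructor zeroMinor
  field zero-at : ∀ a b → M (r a) (c b) ≡ false

open ZeroMinor

everyMinorHasOne : {M : Matrix01 n} →
                   (∀ r c → Injective _≡_ _≡_ r → Injective _≡_ _≡_ c → ¬ ZeroMinor M r c) →
                   EveryMinorHasOne k M
everyMinorHasOne {M = M} no-zero-minor r c r-inj c-inj
  with any? (λ a → any? (λ b → M (r a) (c b) ≟ᵇ true))
... | yes one = one
... | no ∄one = contradiction (zeroMinor λ a b → ¬-not (λ one → ∄one (a , b , one))) (no-zero-minor r c r-inj c-inj)

zeroMinor-∪ˡ : (M N : Matrix01 n) {r c : Fin k → Fin n} → ZeroMinor (M ∪ N) r c → ZeroMinor M r c
zeroMinor-∪ˡ M N {r} {c} zero-minor = zeroMinor λ a b →
  ∨-conicalˡ (M (r a) (c b)) (N (r a) (c b)) (zero-at zero-minor a b)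

zeroMinor-∪ʳ : (M N : Matrix01 n) {r c : Fin k → Fin n} → ZeroMinor (M ∪ N) r c → ZeroMinor N r c
zeroMinor-∪ʳ M N {r} {c} zero-minor = zeroMinor λ a b →
  ∨-conicalʳ (M (r a) (c b)) (N (r a) (c b)) (zero-at zero-minor a b)

infix 4 _∈Im_

_∈Im_ : {A B : Set} → B → (A → B) → Set
y ∈Im f = ∃ λ a → f a ≡ y

zeroMinor-graph : (f : Fin n → Fin n) {r c : Fin k → Fin n} {u : Fin n} →
                  ZeroMinor (graph f) r c → u ∈Im r → f u ∈Im c → ⊥
zeroMinor-graph f {c = c} zero-minor (a , refl) (b , cb≡fu) with
  trans (sym (dec-true (c b ≟ f _) cb≡fu)) (zero-at zero-minor a b)
... | ()

zeroMinor-entry : (u v : Fin n) {r c : Fin k → Fin n} →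
                  ZeroMinor (entry u v) r c → u ∈Im r → v ∈Im c → ⊥
zeroMinor-entry u v {r} {c} zero-minor (a , refl) (b , refl) with
  trans (sym (cong₂ _∧_ (dec-true (r a ≟ r a) refl) (dec-true (c b ≟ c b) refl))) (zero-at zero-minor a b)
... | ()

image-≤ : {A : Set} (f : Fin m → A) (g : Fin n → A) →
          Injective _≡_ _≡_ g → (∀ i → g i ∈Im f) → n ≤ m
image-≤ f g g-inj g⊆f = injective⇒≤ {f = proj₁ ∘ g⊆f} λ {i} {j} eq →
  g-inj (trans (sym (proj₂ (g⊆f i))) (trans (cong f eq) (proj₂ (g⊆f j))))

∃∉Im : (f : Fin m → Fin (suc m)) → ∃ λ x → ¬ x ∈Im f
∃∉Im {m} f = ¬∀⟶∃¬ (suc m) (_∈Im f) (λ y → any? (λ i → f i ≟ y))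
  (λ all∈ → 1+n≰n (image-≤ f id id all∈))

∉Im-unique : {f : Fin m → Fin (suc m)} {x y : Fin (suc m)} →
             Injective _≡_ _≡_ f → ¬ x ∈Im f → ¬ y ∈Im f → x ≡ y
∉Im-unique {m} {f} {x} {y} f-inj x∉ y∉ with x ≟ y
... | yes x≡y = x≡y
... | no x≢y  = contradiction (injective⇒≤ h-inj) 1+n≰n
  where
  x≢f : ∀ i → x ≢ f i
  x≢f i eq = x∉ (i , sym eq)
  h : Fin (suc m) → Fin m
  h zero    = punchOut x≢y
  h (suc i) = punchOut (x≢f i)
  h-inj : Injective _≡_ _≡_ h
  h-inj {zero}  {zero}  _  = refl
  h-inj {zero}  {suc j} eq = contradiction (j , sym (punchOut-injective x≢y (x≢f j) eq)) y∉
  h-inj {suc i} {zero}  eq = contradiction (i , punchOut-injective (x≢f i) x≢y eq) y∉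
  h-inj {suc i} {suc j} eq = cong suc (f-inj (punchOut-injective (x≢f i) (x≢f j) eq))

++-injective : {A : Set} {f : Fin m → A} {g : Fin n → A} →
               Injective _≡_ _≡_ f → Injective _≡_ _≡_ g → (∀ i j → f i ≢ g j) →
               Injective _≡_ _≡_ (f ++ g)
++-injective {m} {n} {f = f} {g} f-inj g-inj f≢g {i} {j} eq =
  trans (sym (join-splitAt m n i))
        (trans (cong (join m n) ([f,g]-injective (splitAt m i) (splitAt m j) eq)) (join-splitAt m n j))
  where
  [f,g]-injective : ∀ s t → [ f , g ] s ≡ [ f , g ] t → s ≡ t
  [f,g]-injective (inj₁ a) (inj₁ b) e = cong inj₁ (f-inj e)
  [f,g]-injective (inj₁ a) (inj₂ b) e = contradiction e (f≢g a b)
  [f,g]-injective (inj₂ a) (inj₁ b) e = contradiction (sym e) (f≢g b a)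
  [f,g]-injective (inj₂ a) (inj₂ b) e = cong inj₂ (g-inj e)

∈Im-++ : {A : Set} {f : Fin m → A} {g : Fin n → A} {y : A} → y ∈Im (f ++ g) → y ∈Im f ⊎ y ∈Im g
∈Im-++ {m} (i , eq) with splitAt m i
... | inj₁ a = inj₁ (a , eq)
... | inj₂ b = inj₂ (b , eq)

propagate : (P : ℕ → Set) {b s t : ℕ} → (∀ u → u < b → P u → P (suc u)) →
            s ≤ t → t ≤ b → P s → P t
propagate P {b} {s} step s≤t = go (≤⇒≤′ s≤t)
  where
  go : ∀ {t} → s ≤′ t → t ≤ b → P s → P t
  go ≤′-refl          _   p = p
  go (≤′-step s≤′t) t<b p = step _ t<b (go s≤′t (<⇒≤ t<b) p)

module _ {n : ℕ} .{{_ : NonZero n}} where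

  infixl 6 _⊕_

  _⊕_ : Fin n → ℕ → Fin n
  x ⊕ t = (toℕ x + t) mod n

  toℕ-⊕ : (x : Fin n) (t : ℕ) → toℕ (x ⊕ t) ≡ (toℕ x + t) % n
  toℕ-⊕ x t = toℕ-fromℕ< (m%n<n (toℕ x + t) n)

  ⊕≡mod : (x : Fin n) (t v : ℕ) → (toℕ x + t) % n ≡ v % n → x ⊕ t ≡ v mod n
  ⊕≡mod x t v eq = toℕ-injective (trans (toℕ-⊕ x t) (trans eq (sym (toℕ-fromℕ< (m%n<n v n)))))

  ⊕-identityʳ : (x : Fin n) → x ⊕ 0 ≡ x
  ⊕-identityʳ x = toℕ-injective
    (trans (toℕ-⊕ x 0) (trans (cong (_% n) (+-identityʳ (toℕ x))) (m<n⇒m%n≡m (toℕ<n x))))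

  ⊕-assoc : (x : Fin n) (s t : ℕ) → x ⊕ s ⊕ t ≡ x ⊕ (s + t)
  ⊕-assoc x s t = toℕ-injective (begin
    toℕ (x ⊕ s ⊕ t)                   ≡⟨ toℕ-⊕ (x ⊕ s) t ⟩
    (toℕ (x ⊕ s) + t) % n             ≡⟨ cong (λ y → (y + t) % n) (toℕ-⊕ x s) ⟩
    ((toℕ x + s) % n + t) % n         ≡⟨ %-distribˡ-+ ((toℕ x + s) % n) t n ⟩
    ((toℕ x + s) % n % n + t % n) % n ≡⟨ cong (λ y → (y + t % n) % n) (m%n%n≡m%n (toℕ x + s) n) ⟩
    ((toℕ x + s) % n + t % n) % n     ≡⟨ %-distribˡ-+ (toℕ x + s) t n ⟨
    (toℕ x + s + t) % n               ≡⟨ cong (_% n) (+-assoc (toℕ x) s t) ⟩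
    (toℕ x + (s + t)) % n             ≡⟨ toℕ-⊕ x (s + t) ⟨
    toℕ (x ⊕ (s + t))                 ∎)
    where open ≡-Reasoning

  ⊕-suc : (x : Fin n) (t : ℕ) → x ⊕ t ⊕ 1 ≡ x ⊕ suc t
  ⊕-suc x t = trans (⊕-assoc x t 1) (cong (x ⊕_) (+-comm t 1))

  -- Adding n ∸ x undoes the rotation by x.
  ⊕-cancelˡ : (x : Fin n) {s t : ℕ} → s < n → t < n → x ⊕ s ≡ x ⊕ t → s ≡ t
  ⊕-cancelˡ x {s} {t} s<n t<n eq = begin
    s                             ≡⟨ retract s<n ⟨
    toℕ (x ⊕ s ⊕ (n ∸ toℕ x))     ≡⟨ cong (λ y → toℕ (y ⊕ (n ∸ toℕ x))) eq ⟩
    toℕ (x ⊕ t ⊕ (n ∸ toℕ x))     ≡⟨ retract t<n ⟩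
    t                             ∎
    where
    open ≡-Reasoning
    retract : ∀ {t} → t < n → toℕ (x ⊕ t ⊕ (n ∸ toℕ x)) ≡ t
    retract {t} t<n = begin
      toℕ (x ⊕ t ⊕ (n ∸ toℕ x))         ≡⟨ cong toℕ (⊕-assoc x t (n ∸ toℕ x)) ⟩
      toℕ (x ⊕ (t + (n ∸ toℕ x)))       ≡⟨ toℕ-⊕ x (t + (n ∸ toℕ x)) ⟩
      (toℕ x + (t + (n ∸ toℕ x))) % n   ≡⟨ cong (_% n) (x∙yz≈y∙xz (toℕ x) t (n ∸ toℕ x)) ⟩
      (t + (toℕ x + (n ∸ toℕ x))) % n   ≡⟨ cong (λ y → (t + y) % n) (m+[n∸m]≡n (<⇒≤ (toℕ<n x))) ⟩
      (t + n) % n                       ≡⟨ [m+n]%n≡m%n t n ⟩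
      t % n                             ≡⟨ m<n⇒m%n≡m t<n ⟩
      t                                 ∎

module CycleMatrix (k : ℕ) where

  N : ℕ
  N = suc (k + k)

  chordColumn : Fin 3 → Fin N
  chordColumn j = (toℕ j * k) mod N

  chord : Fin 3 → Matrix01 N
  chord j = entry (chordColumn j ⊕ k) (chordColumn j)

  chords : Matrix01 N
  chords = chord 0F ∪ chord 1F ∪ chord 2F

  cycleMatrix : Matrix01 N
  cycleMatrix = graph id ∪ graph (_⊕ 1) ∪ chords

  ones-chord : ∀ j → ones (chord j) ≤ 1
  ones-chord j = ≤-reflexive (ones-entry (chordColumn j ⊕ k) (chordColumn j))

  ones-cycleMatrix : ones cycleMatrix ≤ N + (N + (1 + (1 + 1)))
  ones-cycleMatrix =
    ones-∪-≤ (graph id) (graph (_⊕ 1) ∪ chords) (≤-reflexive (ones-graph {N} id))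
      (ones-∪-≤ (graph (_⊕ 1)) chords (≤-reflexive (ones-graph {N} (_⊕ 1)))
        (ones-∪-≤ (chord 0F) (chord 1F ∪ chord 2F) (ones-chord 0F)
          (ones-∪-≤ (chord 1F) (chord 2F) (ones-chord 1F) (ones-chord 2F))))

  chord-window : 1 ≤ k → (x : Fin N) → ∃₂ λ t j → 1 ≤ t × t ≤ k × x ⊕ t ≡ chordColumn j
  chord-window 1≤k x with toℕ x <? k | toℕ x <? k + k
  ... | yes x<k | _ =
    k ∸ toℕ x , 1F , m<n⇒0<n∸m x<k , m∸n≤m k (toℕ x) ,
    ⊕≡mod x (k ∸ toℕ x) (1 * k) (cong (_% N) (trans (m+[n∸m]≡n (<⇒≤ x<k)) (sym (+-identityʳ k))))
  ... | no x≮k | yes x<2k =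
    (k + k) ∸ toℕ x , 2F , m<n⇒0<n∸m x<2k ,
    ≤-trans (∸-monoʳ-≤ (k + k) (≮⇒≥ x≮k)) (≤-reflexive (m+n∸n≡m k k)) ,
    ⊕≡mod x ((k + k) ∸ toℕ x) (2 * k) (cong (_% N) (trans (m+[n∸m]≡n (<⇒≤ x<2k)) (cong (k +_) (sym (+-identityʳ k)))))
  ... | no _ | no x≮2k =
    1 , 0F , ≤-refl , 1≤k ,
    ⊕≡mod x 1 0 (trans (cong (_% N) x+1≡N) (n%n≡0 N))
    where
    x+1≡N : toℕ x + 1 ≡ N
    x+1≡N = trans (+-comm (toℕ x) 1) (cong suc (≤-antisym (toℕ≤pred[n] x) (≮⇒≥ x≮2k)))

  module ZeroMinorContradiction (1≤k : 1 ≤ k) {r c : Fin k → Fin N}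
    (r-inj : Injective _≡_ _≡_ r) (c-inj : Injective _≡_ _≡_ c)
    (zero-minor : ZeroMinor cycleMatrix r c) where

    off-diagonal : ZeroMinor (graph (_⊕ 1) ∪ chords) r c
    off-diagonal = zeroMinor-∪ʳ (graph id) (graph (_⊕ 1) ∪ chords) zero-minor

    no-diagonal : {u : Fin N} → u ∈Im r → u ∈Im c → ⊥
    no-diagonal = zeroMinor-graph id (zeroMinor-∪ˡ (graph id) (graph (_⊕ 1) ∪ chords) zero-minor)

    no-step : {u : Fin N} → u ∈Im r → u ⊕ 1 ∈Im c → ⊥
    no-step = zeroMinor-graph (_⊕ 1) (zeroMinor-∪ˡ (graph (_⊕ 1)) chords off-diagonal)

    no-chord : ∀ j → chordColumn j ⊕ k ∈Im r → chordColumn j ∈Im c → ⊥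
    no-chord j = zeroMinor-entry (chordColumn j ⊕ k) (chordColumn j) (chord-minor j)
      where
      chords-minor : ZeroMinor chords r c
      chords-minor = zeroMinor-∪ʳ (graph (_⊕ 1)) chords off-diagonal
      chord-minor : ∀ j → ZeroMinor (chord j) r c
      chord-minor 0F = zeroMinor-∪ˡ (chord 0F) (chord 1F ∪ chord 2F) chords-minor
      chord-minor 1F = zeroMinor-∪ˡ (chord 1F) (chord 2F) (zeroMinor-∪ʳ (chord 0F) (chord 1F ∪ chord 2F) chords-minor)
      chord-minor 2F = zeroMinor-∪ʳ (chord 1F) (chord 2F) (zeroMinor-∪ʳ (chord 0F) (chord 1F ∪ chord 2F) chords-minor)

    missing : ∃ λ x → ¬ x ∈Im (r ++ c)
    missing = ∃∉Im (r ++ c)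

    x : Fin N
    x = proj₁ missing

    labelled : {y : Fin N} → y ≢ x → y ∈Im r ⊎ y ∈Im c
    labelled {y} y≢x with any? (λ i → (r ++ c) i ≟ y)
    ... | yes y∈ = ∈Im-++ y∈
    ... | no y∉  = contradiction (∉Im-unique rc-inj y∉ (proj₂ missing)) y≢x
      where
      rc-inj : Injective _≡_ _≡_ (r ++ c)
      rc-inj = ++-injective r-inj c-inj (λ a b eq → no-diagonal (a , refl) (b , sym eq))

    pos : ℕ → Fin N
    pos t = x ⊕ t

    pos-injective : {s t : ℕ} → s ≤ k + k → t ≤ k + k → pos s ≡ pos t → s ≡ t
    pos-injective s≤2k t≤2k = ⊕-cancelˡ x (s≤s s≤2k) (s≤s t≤2k)

    pos-labelled : {t : ℕ} → 1 ≤ t → t ≤ k + k → pos t ∈Im r ⊎ pos t ∈Im c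
    pos-labelled 1≤t t≤2k = labelled λ pos-t≡x →
      >⇒≢ 1≤t (pos-injective t≤2k z≤n (trans pos-t≡x (sym (⊕-identityʳ x))))

    rows-upward : {s t : ℕ} → s ≤ t → t ≤ k + k → pos s ∈Im r → pos t ∈Im r
    rows-upward = propagate (λ t → pos t ∈Im r) step
      where
      step : ∀ s → s < k + k → pos s ∈Im r → pos (suc s) ∈Im r
      step s s<2k s∈r with pos-labelled (s≤s z≤n) s<2k
      ... | inj₁ s+1∈r = s+1∈r
      ... | inj₂ s+1∈c = contradiction (subst (_∈Im c) (sym (⊕-suc x s)) s+1∈c) (no-step s∈r)

    early-not-row : {t : ℕ} → t ≤ k → ¬ pos t ∈Im r
    early-not-row {t} t≤k t∈r = 1+n≰n (image-≤ r g g-inj (λ i → rows-upward (m≤m+n t (toℕ i)) (bound i) t∈r))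
      where
      bound : ∀ i → t + toℕ i ≤ k + k
      bound i = +-mono-≤ t≤k (toℕ≤pred[n] i)
      g : Fin (suc k) → Fin N
      g i = pos (t + toℕ i)
      g-inj : Injective _≡_ _≡_ g
      g-inj {i} {j} eq = toℕ-injective (+-cancelˡ-≡ t (toℕ i) (toℕ j) (pos-injective (bound i) (bound j) eq))

    late-not-column : {t : ℕ} → k < t → t ≤ k + k → ¬ pos t ∈Im c
    late-not-column {t} k<t t≤2k t∈c = 1+n≰n (image-≤ c g g-inj column)
      where
      bound : ∀ (i : Fin (suc k)) → suc (toℕ i) ≤ t
      bound i = ≤-trans (s≤s (toℕ≤pred[n] i)) k<t
      g : Fin (suc k) → Fin N
      g i = pos (suc (toℕ i))
      g-inj : Injective _≡_ _≡_ g
      g-inj {i} {j} eq = toℕ-injective (suc-injective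
        (pos-injective (≤-trans (bound i) t≤2k) (≤-trans (bound j) t≤2k) eq))
      column : ∀ i → g i ∈Im c
      column i with pos-labelled (s≤s z≤n) (≤-trans (bound i) t≤2k)
      ... | inj₁ i∈r = contradiction t∈c (no-diagonal (rows-upward (bound i) t≤2k i∈r))
      ... | inj₂ i∈c = i∈c

    early-column : {t : ℕ} → 1 ≤ t → t ≤ k → pos t ∈Im c
    early-column 1≤t t≤k with pos-labelled 1≤t (≤-trans t≤k (m≤m+n k k))
    ... | inj₁ t∈r = contradiction t∈r (early-not-row t≤k)
    ... | inj₂ t∈c = t∈c

    late-row : {t : ℕ} → k < t → t ≤ k + k → pos t ∈Im r
    late-row k<t t≤2k with pos-labelled (≤-trans (s≤s z≤n) k<t) t≤2k
    ... | inj₁ t∈r = t∈r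
    ... | inj₂ t∈c = contradiction t∈c (late-not-column k<t t≤2k)

    absurd : ⊥
    absurd with chord-window 1≤k x
    ... | t , j , 1≤t , t≤k , pos-t≡v = no-chord j
      (subst (_∈Im r) (trans (sym (⊕-assoc x t k)) (cong (_⊕ k) pos-t≡v))
        (late-row (+-monoˡ-≤ k 1≤t) (+-monoˡ-≤ k t≤k)))
      (subst (_∈Im c) pos-t≡v (early-column 1≤t t≤k))

  cycleMatrix-minors : 1 ≤ k → EveryMinorHasOne k cycleMatrix
  cycleMatrix-minors 1≤k = everyMinorHasOne λ _ _ r-inj c-inj zero-minor →
    ZeroMinorContradiction.absurd 1≤k r-inj c-inj zero-minor

lemma8 : (k : ℕ) → 1 ≤ k → α≤ k (2 * k + 1) (4 * k + 5)
lemma8 k 1≤k = subst (λ n → α≤ k n (4 * k + 5)) (size k)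
  (cycleMatrix , cycleMatrix-minors 1≤k , subst (ones cycleMatrix ≤_) (count k) ones-cycleMatrix)
  where
  open CycleMatrix k
  size : ∀ k → suc (k + k) ≡ 2 * k + 1
  size = solve-∀
  count : ∀ k → suc (k + k) + (suc (k + k) + (1 + (1 + 1))) ≡ 4 * k + 5
  count = solve-∀
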